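{- There exists a function $\ell:\mathbb{N}\to\mathbb{N}$ with $\ell(n)=\Theta(n/\log n)$ such that if $(L,M)$ is a random $\ell(n)$-correspondence assignment for the complete graph $K_n$, then with probability tending to $1$ as $n\to\infty$, $K_n$ is $(L,M)$-colorable.
   Context: A correspondence assignment for a graph $G$ is a pair $(L,M)$ where $L$ assigns to each vertex $v$ a finite list $L(v)$ of colors and $M=\{M_e:e\in E(G)\}$ assigns to each edge $e=uv$ a (not necessarily perfect) matching $M_e$ between $\{u\}\times L(u)$ and $\{v\}\times L(v)$. An $(L,M)$-coloring is a map $\varphi$ with $\varphi(v)\in L(v)$ for all $v$ such that for every edge $e=uv$, $(u,\varphi(u))$ and $(v,\varphi(v))$ are not adjacent in $M_e$. A random $\ell$-correspondence assignment for $G$ is the assignment with $L(v)=\{1,\ldots,\ell\}$ for every vertex $v$, where for each edge $e=uv$ the matching $M_e$ is chosen uniformly at random among the perfect matchings between $\{u\}\times\{1,\ldots,\ell\}$ and $\{v\}\times\{1,\ldots,\ell\}$, independently for different edges. -}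

module Defs where

open import Data.Nat using (ℕ; zero; suc; _+_; _*_; _∸_; _≤_)
open import Data.Nat.Logarithm using (⌊log₂_⌋)
open import Data.Fin using (Fin; zero; suc; _<_; _<?_)
open import Data.Fin.Properties using (all?; _≟_)
open import Data.Product using (_×_; _,_; ∃; Σ)
open import Data.List using (List; []; _∷_; map; concatMap; filter; cartesianProduct; length; zip)
open import Data.List.Relation.Unary.All using (All)
open import Data.List.Relation.Binary.Sublist.Propositional using (_⊆_)
open import Relation.Binary.PropositionalEquality using (_≡_)
open import Relation.Nullary using (¬_; Dec)
open import Relation.Nullary.Decidable using (_→-dec_)

cons : ∀ {m k} → Fin k → (Fin m → Fin k) → Fin (suc m) → Fin k
cons c f zero    = c
cons c f (suc i) = f i

allFuns : (m k : ℕ) → List (Fin m → Fin k)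
allFuns zero    k = (λ ()) ∷ []
allFuns (suc m) k = concatMap (λ c → map (cons c) (allFuns m k)) (Data.List.allFin k)

IsPerm : ∀ {ℓ} → (Fin ℓ → Fin ℓ) → Set
IsPerm {ℓ} π = ∀ (i j : Fin ℓ) → π i ≡ π j → i ≡ j

isPerm? : ∀ {ℓ} (π : Fin ℓ → Fin ℓ) → Dec (IsPerm π)
isPerm? π = all? λ i → all? λ j → (π i ≟ π j) →-dec (i ≟ j)

-- All permutations of {1..ℓ}, each listed exactly once.  A perfect matching
-- between {u}×[ℓ] and {v}×[ℓ] is the same thing as a permutation π of [ℓ]
-- ((u,c) is matched with (v, π c)).
perms : (ℓ : ℕ) → List (Fin ℓ → Fin ℓ)
perms ℓ = filter isPerm? (allFuns ℓ ℓ)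

edges : (n : ℕ) → List (Fin n × Fin n)
edges n = filter (λ { (u , v) → u <? v }) (cartesianProduct (Data.List.allFin n) (Data.List.allFin n))

words : ∀ {a} {A : Set a} → List A → ℕ → List (List A)
words xs zero    = [] ∷ []
words xs (suc m) = concatMap (λ x → map (x ∷_) (words xs m)) xs

-- The sample space of a random ℓ-correspondence assignment for K_n: one
-- permutation (= perfect matching) per edge, in the order of 'edges n'.
-- Each outcome is listed exactly once, so the uniform measure on this list is
-- the product of the uniform measures on perfect matchings.
samples : (n ℓ : ℕ) → List (List (Fin ℓ → Fin ℓ))
samples n ℓ = words (perms ℓ) (length (edges n))

Respects : ∀ {n ℓ} → (Fin n → Fin ℓ) → (Fin n × Fin n) × (Fin ℓ → Fin ℓ) → Set
Respects φ ((u , v) , π) = ¬ (π (φ u) ≡ φ v)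

Colorable : (n ℓ : ℕ) → List (Fin ℓ → Fin ℓ) → Set
Colorable n ℓ πs = ∃ λ (φ : Fin n → Fin ℓ) → All (Respects φ) (zip (edges n) πs)

-- P(K_n is colourable) ≥ 1 - 1/(k+1): some set S of outcomes (a sublist of
-- the sample space) consists of colourable outcomes and
-- (k+1) · (#outcomes − |S|) ≤ #outcomes.
ProbColorableAtLeast : (n ℓ k : ℕ) → Set
ProbColorableAtLeast n ℓ k =
  Σ (List (List (Fin ℓ → Fin ℓ))) λ S →
    S ⊆ samples n ℓ × All (Colorable n ℓ) S ×
    suc k * (length (samples n ℓ) ∸ length S) ≤ length (samples n ℓ)

ProbTendsToOne : (ℕ → ℕ) → Set
ProbTendsToOne ℓ = ∀ k → ∃ λ N → ∀ n → N ≤ n → ProbColorableAtLeast n (ℓ n) k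

ThetaNOverLog : (ℕ → ℕ) → Set
ThetaNOverLog ℓ = ∃ λ a → ∃ λ b → ∃ λ C → ∃ λ N →
  ∀ n → N ≤ n →
    (suc a * n ≤ suc b * (ℓ n * ⌊log₂ n ⌋)) × (ℓ n * ⌊log₂ n ⌋ ≤ C * n)

-- Colour the vertices greedily, one at a time. When vertex m is coloured, the edge to each earlier
-- vertex v forbids exactly one colour, the one its matching pairs with the colour of v; since the
-- matchings are uniform and independent, these m forbidden colours are independent and uniform, so
-- vertex m is stuck exactly when m random colours cover all ℓ colours. By negative correlation this
-- has probability at most (1 − (1 − 1/ℓ)^m)^ℓ. For ℓ ≈ 16 n / log₂ n and m < n we have
-- (1 − 1/ℓ)^m ≥ 2^(−t) with t ≈ (log₂ n)/4, which makes the bound far smaller than 1/n, and a union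
-- bound over the n vertices shows that greedy colouring succeeds with probability tending to 1.

module Submission where

open import Defs
open import Data.Bool using (true; false; if_then_else_)
open import Data.Empty using (⊥-elim)
open import Data.Fin using (Fin; zero; suc; _<?_) renaming (_<_ to _<ᶠ_)
open import Data.Fin.Permutation using (Permutation; _⟨$⟩ʳ_; _⟨$⟩ˡ_; inverseˡ; transpose)
open import Data.Fin.Properties using (_≟_)
open import Data.List using (List; []; _∷_; _++_; map; concatMap; filter; cartesianProduct; length; zip; allFin; tabulate; take; drop)
open import Data.List.Membership.Propositional using (_∈_)
open import Data.List.Membership.Propositional.Properties using (∈-concatMap⁻; ∈-map⁻; ∈-filter⁻)
open import Data.List.Properties using (filter-++; map-++; map-∘; map-tabulate; length-++; length-map; length-tabulate; length-filter)
open import Data.List.Relation.Binary.Sublist.Propositional.Properties using (filter-⊆)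
open import Data.List.Relation.Unary.All as All using (All; []; _∷_; all?)
open import Data.List.Relation.Unary.All.Properties using (++⁺; ¬Any⇒All¬; ¬All⇒Any¬) renaming (map⁺ to All-map⁺)
open import Data.List.Relation.Unary.AllPairs using (_∷_)
open import Data.List.Relation.Unary.Any using (Any; here; there; any?; satisfied)
open import Data.List.Relation.Unary.Any.Properties using () renaming (map⁺ to Any-map⁺; map⁻ to Any-map⁻)
open import Data.List.Relation.Unary.Unique.Propositional using (Unique)
import Data.List.Relation.Unary.Unique.Propositional.Properties as Unique
open import Data.Maybe using (Maybe; just; nothing; _>>=_; Is-just)
import Data.Maybe.Relation.Unary.Any as Maybe
open import Data.Nat using (ℕ; zero; suc; _+_; _*_; _∸_; _^_; _≤_; _<_; z≤n; s≤s; NonZero; >-nonZero; _≤?_; ⌊_/2⌋)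
open import Data.Nat.DivMod using (_/_; _%_; m≡m%n+[m/n]*n; m%n<n; m/n*n≤m; /-monoˡ-≤; m*n/n≡m)
open import Data.Nat.Induction using (<-wellFounded)
open import Data.Nat.Logarithm using (⌊log₂_⌋; ⌊log₂[2^n]⌋≡n; ⌊log₂⌋-mono-≤)
open import Data.Nat.Logarithm.Core using (⌊log2⌋)
open import Data.Nat.Properties hiding (_≟_; _<?_)
open import Algebra.Properties.CommutativeMonoid.Sum +-0-commutativeMonoid using (sum; sum-permute; sum-replicate-zero)
open import Algebra.Properties.CommutativeSemigroup +-commutativeSemigroup using () renaming (interchange to +-interchange)
open import Algebra.Properties.CommutativeSemigroup *-commutativeSemigroup using (x∙yz≈y∙xz; xy∙z≈y∙xz; xy∙z≈xz∙y) renaming (interchange to *-interchange)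
open import Data.Nat.Tactic.RingSolver using (solve-∀)
open import Data.Product using (_×_; _,_; proj₁; proj₂; map₁; ∃)
open import Data.Sum using (_⊎_; inj₁; inj₂; [_,_])
open import Data.Unit using (tt)
open import Function using (_∘_; id; _⇔_; mk⇔; Equivalence)
open import Induction.WellFounded using (Acc; acc)
open import Level using (Level)
open import Relation.Binary.Core using (_Preserves_⟶_)
open import Relation.Binary.PropositionalEquality hiding ([_])
open import Relation.Nullary using (Dec; yes; no; does; ¬_; ¬?)
open import Relation.Nullary.Decidable using (does-⇔; dec-true)
open import Relation.Unary using (Pred; Decidable)

private variable
  a b ℓ₁ ℓ₂ : Level
  A : Set a
  B : Set b
  k ℓ m n : ℕ

-- Sums over lists

∑ : List A → (A → ℕ) → ℕ
∑ []       f = 0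
∑ (x ∷ xs) f = f x + ∑ xs f

𝟙[_] : {P : Set ℓ₁} → Dec P → ℕ
𝟙[ P? ] = if does P? then 1 else 0

𝟙-⇔ : {P : Set ℓ₁} {Q : Set ℓ₂} → P ⇔ Q → (P? : Dec P) (Q? : Dec Q) → 𝟙[ P? ] ≡ 𝟙[ Q? ]
𝟙-⇔ P⇔Q P? Q? = cong (λ b → if b then 1 else 0) (does-⇔ P⇔Q P? Q?)

∑-cong∈ : ∀ (xs : List A) {f g : A → ℕ} → (∀ {x} → x ∈ xs → f x ≡ g x) → ∑ xs f ≡ ∑ xs g
∑-cong∈ []       eq = refl
∑-cong∈ (x ∷ xs) eq = cong₂ _+_ (eq (here refl)) (∑-cong∈ xs (eq ∘ there))

∑-cong : ∀ (xs : List A) {f g : A → ℕ} → (∀ x → f x ≡ g x) → ∑ xs f ≡ ∑ xs g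
∑-cong xs eq = ∑-cong∈ xs (λ {x} _ → eq x)

∑-mono∈ : ∀ (xs : List A) {f g : A → ℕ} → (∀ {x} → x ∈ xs → f x ≤ g x) → ∑ xs f ≤ ∑ xs g
∑-mono∈ []       le = z≤n
∑-mono∈ (x ∷ xs) le = +-mono-≤ (le (here refl)) (∑-mono∈ xs (le ∘ there))

∑-const : ∀ (xs : List A) c → ∑ xs (λ _ → c) ≡ length xs * c
∑-const []       c = refl
∑-const (x ∷ xs) c = cong (c +_) (∑-const xs c)

∑-zero : ∀ (xs : List A) → ∑ xs (λ _ → 0) ≡ 0
∑-zero xs = trans (∑-const xs 0) (*-zeroʳ (length xs))

length≡∑1 : ∀ (xs : List A) → length xs ≡ ∑ xs (λ _ → 1)
length≡∑1 xs = sym (trans (∑-const xs 1) (*-identityʳ (length xs)))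

∑-+ : ∀ (xs : List A) f g → ∑ xs (λ x → f x + g x) ≡ ∑ xs f + ∑ xs g
∑-+ []       f g = refl
∑-+ (x ∷ xs) f g = trans (cong (f x + g x +_) (∑-+ xs f g)) (+-interchange (f x) (g x) (∑ xs f) (∑ xs g))

∑-*ˡ : ∀ (xs : List A) c f → ∑ xs (λ x → c * f x) ≡ c * ∑ xs f
∑-*ˡ []       c f = sym (*-zeroʳ c)
∑-*ˡ (x ∷ xs) c f = trans (cong (c * f x +_) (∑-*ˡ xs c f)) (sym (*-distribˡ-+ c (f x) (∑ xs f)))

∑-*ʳ : ∀ (xs : List A) c f → ∑ xs (λ x → f x * c) ≡ ∑ xs f * c
∑-*ʳ xs c f = trans (∑-cong xs (λ x → *-comm (f x) c)) (trans (∑-*ˡ xs c f) (*-comm c (∑ xs f)))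

∑-++ : ∀ (xs ys : List A) f → ∑ (xs ++ ys) f ≡ ∑ xs f + ∑ ys f
∑-++ []       ys f = refl
∑-++ (x ∷ xs) ys f = trans (cong (f x +_) (∑-++ xs ys f)) (sym (+-assoc (f x) (∑ xs f) (∑ ys f)))

∑-map : ∀ (g : A → B) (xs : List A) f → ∑ (map g xs) f ≡ ∑ xs (f ∘ g)
∑-map g []       f = refl
∑-map g (x ∷ xs) f = cong (f (g x) +_) (∑-map g xs f)

∑-concatMap : ∀ (g : A → List B) (xs : List A) f → ∑ (concatMap g xs) f ≡ ∑ xs (λ x → ∑ (g x) f)
∑-concatMap g []       f = refl
∑-concatMap g (x ∷ xs) f = trans (∑-++ (g x) (concatMap g xs) f) (cong (∑ (g x) f +_) (∑-concatMap g xs f))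

∑-comm : ∀ (xs : List A) (ys : List B) (f : A → B → ℕ) →
         ∑ xs (λ x → ∑ ys (f x)) ≡ ∑ ys (λ y → ∑ xs (λ x → f x y))
∑-comm []       ys f = sym (∑-zero ys)
∑-comm (x ∷ xs) ys f = trans (cong (∑ ys (f x) +_) (∑-comm xs ys f)) (sym (∑-+ ys (f x) _))

module _ {P : Pred A ℓ₁} (P? : Decidable P) where

  ∑-filter : ∀ (xs : List A) f → ∑ (filter P? xs) f ≡ ∑ xs (λ x → 𝟙[ P? x ] * f x)
  ∑-filter []       f = refl
  ∑-filter (x ∷ xs) f with P? x
  ... | yes _ = cong₂ _+_ (sym (+-identityʳ (f x))) (∑-filter xs f)
  ... | no _  = ∑-filter xs f

  length-filter≡∑𝟙 : ∀ (xs : List A) → length (filter P? xs) ≡ ∑ xs (λ x → 𝟙[ P? x ])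
  length-filter≡∑𝟙 xs =
    trans (length≡∑1 (filter P? xs)) (trans (∑-filter xs (λ _ → 1)) (∑-cong xs (λ x → *-identityʳ 𝟙[ P? x ])))

  length-filter-¬+∑𝟙 : ∀ (xs : List A) → length (filter (¬? ∘ P?) xs) + ∑ xs (λ x → 𝟙[ P? x ]) ≡ length xs
  length-filter-¬+∑𝟙 []       = refl
  length-filter-¬+∑𝟙 (x ∷ xs) with P? x
  ... | yes _ = trans (+-suc _ _) (cong suc (length-filter-¬+∑𝟙 xs))
  ... | no _  = cong suc (length-filter-¬+∑𝟙 xs)


∑-words-suc : ∀ (xs : List A) m f → ∑ (words xs (suc m)) f ≡ ∑ xs (λ x → ∑ (words xs m) (λ w → f (x ∷ w)))
∑-words-suc xs m f = trans (∑-concatMap _ xs f) (∑-cong xs (λ x → ∑-map (x ∷_) (words xs m) f))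

∑-words-+ : ∀ (xs : List A) m n f →
            ∑ (words xs (m + n)) f ≡ ∑ (words xs m) (λ us → ∑ (words xs n) (λ vs → f (us ++ vs)))
∑-words-+ xs zero    n f = sym (+-identityʳ _)
∑-words-+ xs (suc m) n f = begin
  ∑ (words xs (suc (m + n))) f
    ≡⟨ ∑-words-suc xs (m + n) f ⟩
  ∑ xs (λ x → ∑ (words xs (m + n)) (λ w → f (x ∷ w)))
    ≡⟨ ∑-cong xs (λ x → ∑-words-+ xs m n (λ w → f (x ∷ w))) ⟩
  ∑ xs (λ x → ∑ (words xs m) (λ us → ∑ (words xs n) (λ vs → f (x ∷ us ++ vs))))
    ≡⟨ sym (∑-words-suc xs m _) ⟩
  ∑ (words xs (suc m)) (λ us → ∑ (words xs n) (λ vs → f (us ++ vs))) ∎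
  where open ≡-Reasoning

length-words : ∀ (xs : List A) m → length (words xs m) ≡ length xs ^ m
length-words xs zero    = refl
length-words xs (suc m) = begin
  length (words xs (suc m))                ≡⟨ length≡∑1 (words xs (suc m)) ⟩
  ∑ (words xs (suc m)) (λ _ → 1)           ≡⟨ ∑-words-suc xs m _ ⟩
  ∑ xs (λ _ → ∑ (words xs m) (λ _ → 1))    ≡⟨ ∑-cong xs (λ _ → sym (length≡∑1 (words xs m))) ⟩
  ∑ xs (λ _ → length (words xs m))         ≡⟨ ∑-const xs _ ⟩
  length xs * length (words xs m)          ≡⟨ cong (length xs *_) (length-words xs m) ⟩
  length xs * length xs ^ m ∎
  where open ≡-Reasoning

∈-words⇒length : ∀ (xs : List A) m {w} → w ∈ words xs m → length w ≡ m
∈-words⇒length xs zero    (here refl) = refl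
∈-words⇒length xs (suc m) w∈ with satisfied (∈-concatMap⁻ _ {xs = xs} w∈)
... | x , w∈′ with ∈-map⁻ (x ∷_) w∈′
... | w′ , w′∈ , refl = cong suc (∈-words⇒length xs m w′∈)


-- The edges of K_(n+1)

module _ {P : Pred B ℓ₁} {Q : Pred A ℓ₂} (P? : Decidable P) (Q? : Decidable Q) (f : A → B) where

  filter-map : (∀ x → does (P? (f x)) ≡ does (Q? x)) → ∀ xs → filter P? (map f xs) ≡ map f (filter Q? xs)
  filter-map eq []       = refl
  filter-map eq (x ∷ xs) with does (P? (f x)) | does (Q? x) | eq x
  ... | true  | true  | _ = cong (f x ∷_) (filter-map eq xs)
  ... | false | false | _ = filter-map eq xs

IsEdge : ∀ {n} → Pred (Fin n × Fin n) _
IsEdge (u , v) = u <ᶠ v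

isEdge? : ∀ {n} → Decidable (IsEdge {n})
isEdge? (u , v) = u <? v

liftEdge : ∀ {n} → Fin n × Fin n → Fin (suc n) × Fin (suc n)
liftEdge (u , v) = suc u , suc v

starEdges : ∀ n → List (Fin (suc n) × Fin (suc n))
starEdges n = map (λ v → zero , suc v) (allFin n)

private
  filter-star : ∀ {n} (vs : List (Fin n)) →
                filter isEdge? (map (zero ,_) (map suc vs)) ≡ map (λ v → zero , suc v) vs
  filter-star []       = refl
  filter-star (v ∷ vs) = cong ((zero , suc v) ∷_) (filter-star vs)

  filter-rows : ∀ {n} (us vs : List (Fin n)) →
                filter isEdge? (cartesianProduct (map suc us) (zero ∷ map suc vs)) ≡
                map liftEdge (filter isEdge? (cartesianProduct us vs))
  filter-rows []       vs = refl
  filter-rows (u ∷ us) vs = begin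
    filter isEdge? (map (suc u ,_) (map suc vs) ++ cartesianProduct (map suc us) (zero ∷ map suc vs))
      ≡⟨ filter-++ isEdge? (map (suc u ,_) (map suc vs)) _ ⟩
    filter isEdge? (map (suc u ,_) (map suc vs)) ++ filter isEdge? (cartesianProduct (map suc us) (zero ∷ map suc vs))
      ≡⟨ cong₂ _++_ row (filter-rows us vs) ⟩
    map liftEdge (filter isEdge? (map (u ,_) vs)) ++ map liftEdge (filter isEdge? (cartesianProduct us vs))
      ≡⟨ sym (map-++ liftEdge (filter isEdge? (map (u ,_) vs)) _) ⟩
    map liftEdge (filter isEdge? (map (u ,_) vs) ++ filter isEdge? (cartesianProduct us vs))
      ≡⟨ cong (map liftEdge) (sym (filter-++ isEdge? (map (u ,_) vs) _)) ⟩
    map liftEdge (filter isEdge? (cartesianProduct (u ∷ us) vs)) ∎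
    where
    open ≡-Reasoning
    row : filter isEdge? (map (suc u ,_) (map suc vs)) ≡ map liftEdge (filter isEdge? (map (u ,_) vs))
    row = begin
      filter isEdge? (map (suc u ,_) (map suc vs))  ≡⟨ cong (filter isEdge?) (map-∘ vs) ⟨
      filter isEdge? (map (liftEdge ∘ (u ,_)) vs)   ≡⟨ cong (filter isEdge?) (map-∘ vs) ⟩
      filter isEdge? (map liftEdge (map (u ,_) vs)) ≡⟨ filter-map isEdge? isEdge? liftEdge (λ _ → refl) (map (u ,_) vs) ⟩
      map liftEdge (filter isEdge? (map (u ,_) vs)) ∎

edges-suc : ∀ n → edges (suc n) ≡ starEdges n ++ map liftEdge (edges n)
edges-suc n = begin
  filter isEdge? (cartesianProduct (zero ∷ tabulate suc) (zero ∷ tabulate suc))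
    ≡⟨ cong (λ vs → filter isEdge? (cartesianProduct (zero ∷ vs) (zero ∷ vs))) (sym (map-tabulate id suc)) ⟩
  filter isEdge? (map (zero ,_) (map suc vs) ++ cartesianProduct (map suc vs) (zero ∷ map suc vs))
    ≡⟨ filter-++ isEdge? (map (zero ,_) (map suc vs)) _ ⟩
  filter isEdge? (map (zero ,_) (map suc vs)) ++ filter isEdge? (cartesianProduct (map suc vs) (zero ∷ map suc vs))
    ≡⟨ cong₂ _++_ (filter-star vs) (filter-rows vs vs) ⟩
  starEdges n ++ map liftEdge (edges n) ∎
  where
  open ≡-Reasoning
  vs = allFin n

length-starEdges : ∀ n → length (starEdges n) ≡ n
length-starEdges n = trans (length-map _ (allFin n)) (length-tabulate id)

length-edges-suc : ∀ n → length (edges (suc n)) ≡ n + length (edges n)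
length-edges-suc n = begin
  length (edges (suc n))                                 ≡⟨ cong length (edges-suc n) ⟩
  length (starEdges n ++ map liftEdge (edges n))         ≡⟨ length-++ (starEdges n) ⟩
  length (starEdges n) + length (map liftEdge (edges n)) ≡⟨ cong₂ _+_ (length-starEdges n) (length-map liftEdge (edges n)) ⟩
  n + length (edges n) ∎
  where open ≡-Reasoning


-- The greedy colouring

zip-mapˡ : ∀ {C : Set ℓ₁} (f : A → B) (xs : List A) (ys : List C) → zip (map f xs) ys ≡ map (map₁ f) (zip xs ys)
zip-mapˡ f []       ys       = refl
zip-mapˡ f (x ∷ xs) []       = refl
zip-mapˡ f (x ∷ xs) (y ∷ ys) = cong (_ ∷_) (zip-mapˡ f xs ys)

zip-++ˡ : ∀ (xs ys : List A) (zs : List B) →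
          zip (xs ++ ys) zs ≡ zip xs (take (length xs) zs) ++ zip ys (drop (length xs) zs)
zip-++ˡ []       ys zs       = refl
zip-++ˡ (x ∷ xs) [] []       = refl
zip-++ˡ (x ∷ xs) (y ∷ ys) [] = refl
zip-++ˡ (x ∷ xs) ys (z ∷ zs) = cong ((x , z) ∷_) (zip-++ˡ xs ys zs)

take-++ : ∀ (xs ys : List A) → take (length xs) (xs ++ ys) ≡ xs
take-++ []       ys = refl
take-++ (x ∷ xs) ys = cong (x ∷_) (take-++ xs ys)

drop-++ : ∀ (xs ys : List A) → drop (length xs) (xs ++ ys) ≡ ys
drop-++ []       ys = refl
drop-++ (x ∷ xs) ys = drop-++ xs ys

-- Colour c of a new vertex is blocked by the colouring φ of the old vertices if the matching πs[v]
-- of the edge to some old vertex v matches c with φ v.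
Blocked : (Fin m → Fin ℓ) → List (Fin ℓ → Fin ℓ) → Pred (Fin ℓ) _
Blocked {m} φ πs c = Any (λ (v , π) → π c ≡ φ v) (zip (allFin m) πs)

blocked? : (φ : Fin m → Fin ℓ) (πs : List (Fin ℓ → Fin ℓ)) (c : Fin ℓ) → Dec (Blocked φ πs c)
blocked? {m} φ πs c = any? (λ (v , π) → π c ≟ φ v) (zip (allFin m) πs)

zip-edges-suc : ∀ n (πs : List A) →
                zip (edges (suc n)) πs ≡
                map (map₁ (λ v → zero , suc v)) (zip (allFin n) (take n πs)) ++ map (map₁ liftEdge) (zip (edges n) (drop n πs))
zip-edges-suc n πs = begin
  zip (edges (suc n)) πs
    ≡⟨ cong (λ es → zip es πs) (edges-suc n) ⟩
  zip (starEdges n ++ map liftEdge (edges n)) πs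
    ≡⟨ zip-++ˡ (starEdges n) (map liftEdge (edges n)) πs ⟩
  zip (starEdges n) (take (length (starEdges n)) πs) ++ zip (map liftEdge (edges n)) (drop (length (starEdges n)) πs)
    ≡⟨ cong (λ k → zip (starEdges n) (take k πs) ++ zip (map liftEdge (edges n)) (drop k πs)) (length-starEdges n) ⟩
  zip (starEdges n) (take n πs) ++ zip (map liftEdge (edges n)) (drop n πs)
    ≡⟨ cong₂ _++_ (zip-mapˡ _ (allFin n) (take n πs)) (zip-mapˡ liftEdge (edges n) (drop n πs)) ⟩
  map (map₁ (λ v → zero , suc v)) (zip (allFin n) (take n πs)) ++ map (map₁ liftEdge) (zip (edges n) (drop n πs)) ∎
  where open ≡-Reasoning

cons-respects : ∀ (φ : Fin n → Fin ℓ) c πs → ¬ Blocked φ (take n πs) c →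
                All (Respects φ) (zip (edges n) (drop n πs)) → All (Respects (cons c φ)) (zip (edges (suc n)) πs)
cons-respects {n} φ c πs free respects =
  subst (All (Respects (cons c φ))) (sym (zip-edges-suc n πs)) (++⁺ (All-map⁺ (¬Any⇒All¬ _ free)) (All-map⁺ respects))

freeColour : (φ : Fin m → Fin ℓ) (πs : List (Fin ℓ → Fin ℓ)) → ¬ All (Blocked φ πs) (allFin ℓ) →
             ∃ λ c → ¬ Blocked φ πs c
freeColour φ πs notStuck = satisfied (¬All⇒Any¬ (blocked? φ πs) (allFin _) notStuck)

extend : (φ : Fin m → Fin ℓ) (πs : List (Fin ℓ → Fin ℓ)) → Dec (All (Blocked φ πs) (allFin ℓ)) →
         Maybe (Fin (suc m) → Fin ℓ)
extend φ πs (yes _)        = nothing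
extend φ πs (no notStuck) = just (cons (proj₁ (freeColour φ πs notStuck)) φ)

-- The vertex zero of K_(n+1) is coloured last, after K_n on the vertices suc v; this matches the
-- order of 'edges (suc n)', which lists the n edges at zero first.
greedy : ∀ n → List (Fin ℓ → Fin ℓ) → Maybe (Fin n → Fin ℓ)
greedy zero    πs = just (λ ())
greedy (suc n) πs = greedy n (drop n πs) >>= λ φ → extend φ (take n πs) (all? (blocked? φ (take n πs)) (allFin _))

greedy-respects : ∀ n (πs : List (Fin ℓ → Fin ℓ)) {φ} → greedy n πs ≡ just φ → All (Respects φ) (zip (edges n) πs)
greedy-respects zero    πs refl = []
greedy-respects {ℓ} (suc n) πs eq with greedy n (drop n πs) in eqφ
... | just φ with all? (blocked? φ (take n πs)) (allFin ℓ)
... | no notStuck with freeColour φ (take n πs) notStuck | eq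
... | c , c-free | refl = cons-respects φ c πs c-free (greedy-respects n (drop n πs) eqφ)

fails : Maybe A → ℕ
fails nothing  = 1
fails (just _) = 0

stuck : Maybe (Fin m → Fin ℓ) → List (Fin ℓ → Fin ℓ) → ℕ
stuck nothing  πs = 0
stuck (just φ) πs = 𝟙[ all? (blocked? φ πs) (allFin _) ]

fails-greedy-++ : ∀ n (xs ys : List (Fin ℓ → Fin ℓ)) → length xs ≡ n →
                  fails (greedy (suc n) (xs ++ ys)) ≡ fails (greedy n ys) + stuck (greedy n ys) xs
fails-greedy-++ {ℓ} n xs ys refl rewrite take-++ xs ys | drop-++ xs ys with greedy (length xs) ys
... | nothing = refl
... | just φ with all? (blocked? φ xs) (allFin ℓ)
...   | yes _ = refl
...   | no _  = refl

failures : ℕ → ℕ → ℕ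
failures n ℓ = ∑ (samples n ℓ) (fails ∘ greedy n)

failures-suc : ∀ n ℓ → failures (suc n) ℓ ≡
               length (perms ℓ) ^ n * failures n ℓ + ∑ (samples n ℓ) (λ ys → ∑ (words (perms ℓ) n) (stuck (greedy n ys)))
failures-suc n ℓ = begin
  ∑ (words P (length (edges (suc n)))) (fails ∘ greedy (suc n))
    ≡⟨ cong (λ k → ∑ (words P k) (fails ∘ greedy (suc n))) (length-edges-suc n) ⟩
  ∑ (words P (n + E)) (fails ∘ greedy (suc n))
    ≡⟨ ∑-words-+ P n E _ ⟩
  ∑ (words P n) (λ xs → ∑ (samples n ℓ) (λ ys → fails (greedy (suc n) (xs ++ ys))))
    ≡⟨ ∑-cong∈ (words P n) (λ {xs} xs∈ →
         ∑-cong (samples n ℓ) (λ ys → fails-greedy-++ n xs ys (∈-words⇒length P n xs∈))) ⟩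
  ∑ (words P n) (λ xs → ∑ (samples n ℓ) (λ ys → fails (greedy n ys) + stuck (greedy n ys) xs))
    ≡⟨ ∑-cong (words P n) (λ xs → ∑-+ (samples n ℓ) _ _) ⟩
  ∑ (words P n) (λ xs → failures n ℓ + ∑ (samples n ℓ) (λ ys → stuck (greedy n ys) xs))
    ≡⟨ ∑-+ (words P n) _ _ ⟩
  ∑ (words P n) (λ _ → failures n ℓ) + ∑ (words P n) (λ xs → ∑ (samples n ℓ) (λ ys → stuck (greedy n ys) xs))
    ≡⟨ cong₂ _+_ (trans (∑-const (words P n) _) (cong (_* failures n ℓ) (length-words P n)))
                 (∑-comm (words P n) (samples n ℓ) _) ⟩
  length P ^ n * failures n ℓ + ∑ (samples n ℓ) (λ ys → ∑ (words P n) (stuck (greedy n ys))) ∎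
  where
  open ≡-Reasoning
  P = perms ℓ
  E = length (edges n)

length-samples-suc : ∀ n ℓ → length (samples (suc n) ℓ) ≡ length (perms ℓ) ^ n * length (samples n ℓ)
length-samples-suc n ℓ = begin
  length (words P (length (edges (suc n))))  ≡⟨ length-words P (length (edges (suc n))) ⟩
  length P ^ length (edges (suc n))          ≡⟨ cong (length P ^_) (length-edges-suc n) ⟩
  length P ^ (n + length (edges n))          ≡⟨ ^-distribˡ-+-* (length P) n _ ⟩
  length P ^ n * length P ^ length (edges n) ≡⟨ cong (length P ^ n *_) (sym (length-words P (length (edges n)))) ⟩
  length P ^ n * length (samples n ℓ) ∎
  where
  open ≡-Reasoning
  P = perms ℓ

-- The union bound over the vertices.
failures-bound : ∀ K n ℓ →
  (∀ m → m < n → ∀ (φ : Fin m → Fin ℓ) → K * ∑ (words (perms ℓ) m) (stuck (just φ)) ≤ length (perms ℓ) ^ m) →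
  K * failures n ℓ ≤ n * length (samples n ℓ)
failures-bound K n ℓ stuck-bound = go n ≤-refl
  where
  go : ∀ m → m ≤ n → K * failures m ℓ ≤ m * length (samples m ℓ)
  go zero    _     = ≤-reflexive (*-zeroʳ K)
  go (suc m) m<n = begin
    K * failures (suc m) ℓ
      ≡⟨ cong (K *_) (failures-suc m ℓ) ⟩
    K * (Q * failures m ℓ + S)
      ≡⟨ regroup K Q (failures m ℓ) S ⟩
    Q * (K * failures m ℓ) + K * S
      ≤⟨ +-mono-≤ (*-monoʳ-≤ Q (go m (<⇒≤ m<n))) KS≤ ⟩
    Q * (m * R) + R * Q
      ≡⟨ collect Q m R ⟩
    suc m * (Q * R)
      ≡⟨ cong (suc m *_) (sym (length-samples-suc m ℓ)) ⟩
    suc m * length (samples (suc m) ℓ) ∎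
    where
    open ≤-Reasoning
    P = perms ℓ
    Q = length P ^ m
    R = length (samples m ℓ)
    S = ∑ (samples m ℓ) (λ ys → ∑ (words P m) (stuck (greedy m ys)))
    regroup : ∀ k q f s → k * (q * f + s) ≡ q * (k * f) + k * s
    regroup = solve-∀
    collect : ∀ q m r → q * (m * r) + r * q ≡ suc m * (q * r)
    collect = solve-∀
    stuck-bound′ : ∀ ys → K * ∑ (words P m) (stuck (greedy m ys)) ≤ Q
    stuck-bound′ ys with greedy m ys
    ... | nothing = ≤-trans (≤-reflexive (trans (cong (K *_) (∑-zero (words P m))) (*-zeroʳ K))) z≤n
    ... | just φ  = stuck-bound m m<n φ
    KS≤ : K * S ≤ R * Q
    KS≤ = begin
      K * S
        ≡⟨ ∑-*ˡ (samples m ℓ) K _ ⟨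
      ∑ (samples m ℓ) (λ ys → K * ∑ (words P m) (stuck (greedy m ys)))
        ≤⟨ ∑-mono∈ (samples m ℓ) (λ {ys} _ → stuck-bound′ ys) ⟩
      ∑ (samples m ℓ) (λ _ → Q)
        ≡⟨ ∑-const (samples m ℓ) Q ⟩
      R * Q ∎


-- Counting the outcomes in which a vertex is stuck

∑-tabulate : ∀ (g : Fin k → A) h → ∑ (tabulate g) h ≡ sum (h ∘ g)
∑-tabulate {k = zero}  g h = refl
∑-tabulate {k = suc k} g h = cong (h (g zero) +_) (∑-tabulate (g ∘ suc) h)

∑-allFin-permute : ∀ (σ : Permutation k k) h → ∑ (allFin k) (h ∘ (σ ⟨$⟩ʳ_)) ≡ ∑ (allFin k) h
∑-allFin-permute σ h = trans (∑-tabulate id (h ∘ (σ ⟨$⟩ʳ_))) (trans (sym (sum-permute h σ)) (sym (∑-tabulate id h)))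

∑-allFin-𝟙≟ : ∀ (x : Fin k) → ∑ (allFin k) (λ t → 𝟙[ x ≟ t ]) ≡ 1
∑-allFin-𝟙≟ x = trans (∑-tabulate id (λ t → 𝟙[ x ≟ t ])) (sum-𝟙≟ x)
  where
  sum-𝟙≟ : ∀ {k} (x : Fin k) → sum (λ t → 𝟙[ x ≟ t ]) ≡ 1
  sum-𝟙≟ {suc k} zero    = cong suc (sum-replicate-zero k)
  sum-𝟙≟ {suc k} (suc x) = sum-𝟙≟ x

∑-allFuns-postcomp : ∀ m (σ : Permutation k k) (g : (Fin m → Fin k) → ℕ) → g Preserves _≗_ ⟶ _≡_ →
                     ∑ (allFuns m k) (λ f → g ((σ ⟨$⟩ʳ_) ∘ f)) ≡ ∑ (allFuns m k) g
∑-allFuns-postcomp zero    σ g g-ext = cong (_+ 0) (g-ext (λ ()))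
∑-allFuns-postcomp {k} (suc m) σ g g-ext = begin
  ∑ (concatMap (λ c → map (cons c) (allFuns m k)) (allFin k)) (λ f → g (τ ∘ f))
    ≡⟨ ∑-allFuns-suc (λ f → g (τ ∘ f)) ⟩
  ∑ (allFin k) (λ c → ∑ (allFuns m k) (λ f → g (τ ∘ cons c f)))
    ≡⟨ ∑-cong (allFin k) (λ c → ∑-cong (allFuns m k) (λ f → g-ext λ { zero → refl ; (suc i) → refl })) ⟩
  ∑ (allFin k) (λ c → ∑ (allFuns m k) (λ f → g (cons (τ c) (τ ∘ f))))
    ≡⟨ ∑-cong (allFin k) (λ c → ∑-allFuns-postcomp m σ (g ∘ cons (τ c))
                                  (λ f≗f′ → g-ext λ { zero → refl ; (suc i) → f≗f′ i })) ⟩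
  ∑ (allFin k) (λ c → ∑ (allFuns m k) (g ∘ cons (τ c)))
    ≡⟨ ∑-allFin-permute σ (λ c → ∑ (allFuns m k) (g ∘ cons c)) ⟩
  ∑ (allFin k) (λ c → ∑ (allFuns m k) (g ∘ cons c))
    ≡⟨ ∑-allFuns-suc g ⟨
  ∑ (allFuns (suc m) k) g ∎
  where
  open ≡-Reasoning
  τ = σ ⟨$⟩ʳ_
  ∑-allFuns-suc : ∀ h → ∑ (allFuns (suc m) k) h ≡ ∑ (allFin k) (λ c → ∑ (allFuns m k) (h ∘ cons c))
  ∑-allFuns-suc h = trans (∑-concatMap _ (allFin k) h) (∑-cong (allFin k) (λ c → ∑-map (cons c) (allFuns m k) h))

length-allFin : ∀ k → length (allFin k) ≡ k
length-allFin k = length-tabulate id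

module _ {ℓ : ℕ} where

  fibre : Fin ℓ → Fin ℓ → ℕ
  fibre c t = ∑ (perms ℓ) (λ π → 𝟙[ π c ≟ t ])

  private
    fibre-weight : Fin ℓ → Fin ℓ → (Fin ℓ → Fin ℓ) → ℕ
    fibre-weight c t f = 𝟙[ isPerm? f ] * 𝟙[ f c ≟ t ]

    fibre≡∑allFuns : ∀ c t → fibre c t ≡ ∑ (allFuns ℓ ℓ) (fibre-weight c t)
    fibre≡∑allFuns c t = ∑-filter isPerm? (allFuns ℓ ℓ) _

    fibre-weight-ext : ∀ c t → fibre-weight c t Preserves _≗_ ⟶ _≡_
    fibre-weight-ext c t f≗f′ = cong₂ _*_
      (𝟙-⇔ (mk⇔ (λ inj i j e → inj i j (trans (f≗f′ i) (trans e (sym (f≗f′ j)))))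
                (λ inj i j e → inj i j (trans (sym (f≗f′ i)) (trans e (f≗f′ j))))) (isPerm? _) (isPerm? _))
      (𝟙-⇔ (mk⇔ (trans (sym (f≗f′ c))) (trans (f≗f′ c))) (_ ≟ t) (_ ≟ t))

  fibre-independent : ∀ c t t′ → fibre c t′ ≡ fibre c t
  fibre-independent c t t′ = begin
    fibre c t′                                       ≡⟨ fibre≡∑allFuns c t′ ⟩
    ∑ (allFuns ℓ ℓ) (fibre-weight c t′)              ≡⟨ ∑-cong (allFuns ℓ ℓ) weight-τ ⟨
    ∑ (allFuns ℓ ℓ) (λ f → fibre-weight c t (τ ∘ f))
      ≡⟨ ∑-allFuns-postcomp ℓ σ (fibre-weight c t) (fibre-weight-ext c t) ⟩
    ∑ (allFuns ℓ ℓ) (fibre-weight c t)               ≡⟨ fibre≡∑allFuns c t ⟨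
    fibre c t ∎
    where
    open ≡-Reasoning
    σ = transpose t′ t
    τ = σ ⟨$⟩ʳ_
    τt′≡t : τ t′ ≡ t
    τt′≡t rewrite dec-true (t′ ≟ t′) refl = refl
    τ-injective : ∀ {x y} → τ x ≡ τ y → x ≡ y
    τ-injective {x} {y} e = trans (sym (inverseˡ σ)) (trans (cong (σ ⟨$⟩ˡ_) e) (inverseˡ σ))
    weight-τ : ∀ f → fibre-weight c t (τ ∘ f) ≡ fibre-weight c t′ f
    weight-τ f = cong₂ _*_
      (𝟙-⇔ (mk⇔ (λ inj i j e → inj i j (cong τ e)) (λ inj i j e → inj i j (τ-injective e)))
           (isPerm? (τ ∘ f)) (isPerm? f))
      (𝟙-⇔ (mk⇔ (λ e → τ-injective (trans e (sym τt′≡t))) (λ e → trans (cong τ e) τt′≡t))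
           (τ (f c) ≟ t) (f c ≟ t′))

  *-fibre : ∀ c t → ℓ * fibre c t ≡ length (perms ℓ)
  *-fibre c t = begin
    ℓ * fibre c t                                           ≡⟨ cong (_* fibre c t) (length-allFin ℓ) ⟨
    length (allFin ℓ) * fibre c t                           ≡⟨ ∑-const (allFin ℓ) (fibre c t) ⟨
    ∑ (allFin ℓ) (λ _ → fibre c t)                          ≡⟨ ∑-cong (allFin ℓ) (fibre-independent c t) ⟨
    ∑ (allFin ℓ) (λ t′ → ∑ (perms ℓ) (λ π → 𝟙[ π c ≟ t′ ])) ≡⟨ ∑-comm (allFin ℓ) (perms ℓ) _ ⟩
    ∑ (perms ℓ) (λ π → ∑ (allFin ℓ) (λ t′ → 𝟙[ π c ≟ t′ ])) ≡⟨ ∑-cong (perms ℓ) (λ π → ∑-allFin-𝟙≟ (π c)) ⟩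
    ∑ (perms ℓ) (λ _ → 1)                                   ≡⟨ length≡∑1 (perms ℓ) ⟨
    length (perms ℓ) ∎
    where open ≡-Reasoning


module _ {P E Q : Pred A ℓ₁} (E? : Decidable E) (P⇔E⊎Q : ∀ {x} → P x ⇔ (E x ⊎ Q x)) where
  open Equivalence

  All-filter-⇔ : ∀ xs → All P xs ⇔ All Q (filter (¬? ∘ E?) xs)
  All-filter-⇔ xs = mk⇔ (to′ xs) (from′ xs)
    where
    to′ : ∀ xs → All P xs → All Q (filter (¬? ∘ E?) xs)
    to′ []       []       = []
    to′ (x ∷ xs) (p ∷ ps) with E? x
    ... | yes _  = to′ xs ps
    ... | no ¬e  = [ ⊥-elim ∘ ¬e , id ] (to P⇔E⊎Q p) ∷ to′ xs ps
    from′ : ∀ xs → All Q (filter (¬? ∘ E?) xs) → All P xs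
    from′ []       _        = []
    from′ (x ∷ xs) qs       with E? x
    ... | yes e                 = from P⇔E⊎Q (inj₁ e) ∷ from′ xs qs
    from′ (x ∷ xs) (q ∷ qs) | no _ = from P⇔E⊎Q (inj₂ q) ∷ from′ xs qs

Blocked-∷ : ∀ (φ : Fin (suc m) → Fin ℓ) π πs c →
            Blocked φ (π ∷ πs) c ⇔ (π c ≡ φ zero ⊎ Blocked (φ ∘ suc) πs c)
Blocked-∷ {m} φ π πs c = mk⇔ to from
  where
  shift : zip (tabulate suc) πs ≡ map (map₁ suc) (zip (allFin m) πs)
  shift = trans (cong (λ vs → zip vs πs) (sym (map-tabulate id suc))) (zip-mapˡ suc (allFin m) πs)
  to : Blocked φ (π ∷ πs) c → π c ≡ φ zero ⊎ Blocked (φ ∘ suc) πs c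
  to (here e)  = inj₁ e
  to (there b) = inj₂ (Any-map⁻ (subst (Any _) shift b))
  from : π c ≡ φ zero ⊎ Blocked (φ ∘ suc) πs c → Blocked φ (π ∷ πs) c
  from (inj₁ e) = here e
  from (inj₂ b) = there (subst (Any _) (sym shift) (Any-map⁺ b))

-- The colours of R still to be blocked by the other edges once the first edge, with matching π,
-- blocks the colour c with π c ≡ t (where t = φ zero).
unblocked : (Fin ℓ → Fin ℓ) → Fin ℓ → List (Fin ℓ) → List (Fin ℓ)
unblocked π t = filter (λ c → ¬? (π c ≟ t))

All-Blocked-∷ : ∀ (φ : Fin (suc m) → Fin ℓ) π πs R →
                All (Blocked φ (π ∷ πs)) R ⇔ All (Blocked (φ ∘ suc) πs) (unblocked π (φ zero) R)
All-Blocked-∷ φ π πs = All-filter-⇔ (λ c → π c ≟ φ zero) (Blocked-∷ φ π πs _)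

hits : (Fin ℓ → Fin ℓ) → Fin ℓ → List (Fin ℓ) → ℕ
hits π t R = ∑ R (λ c → 𝟙[ π c ≟ t ])

length-unblocked : ∀ π t (R : List (Fin ℓ)) → length (unblocked π t R) + hits π t R ≡ length R
length-unblocked π t = length-filter-¬+∑𝟙 (λ c → π c ≟ t)

hits≤1 : ∀ {π : Fin ℓ → Fin ℓ} t {R} → IsPerm π → Unique R → hits π t R ≤ 1
hits≤1         t {[]}    π-inj _            = z≤n
hits≤1 {π = π} t {c ∷ R} π-inj (c∉R ∷ uniq) with π c ≟ t
... | no _   = hits≤1 t π-inj uniq
... | yes πc≡t =
  s≤s (≤-reflexive (misses R (All.map (λ c≢c′ πc′≡t → c≢c′ (π-inj _ _ (trans πc≡t (sym πc′≡t)))) c∉R)))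
  where
  misses : ∀ R → All (λ c′ → ¬ π c′ ≡ t) R → hits π t R ≡ 0
  misses []       []          = refl
  misses (c′ ∷ R) (¬hit ∷ ¬hits) with π c′ ≟ t
  ... | yes hit = ⊥-elim (¬hit hit)
  ... | no _    = misses R ¬hits

*-∑-hits : ∀ t (R : List (Fin ℓ)) → ℓ * ∑ (perms ℓ) (λ π → hits π t R) ≡ length R * length (perms ℓ)
*-∑-hits {ℓ} t R = begin
  ℓ * ∑ (perms ℓ) (λ π → hits π t R)       ≡⟨ cong (ℓ *_) (∑-comm (perms ℓ) R _) ⟩
  ℓ * ∑ R (λ c → fibre c t)                ≡⟨ ∑-*ˡ R ℓ _ ⟨
  ∑ R (λ c → ℓ * fibre c t)                ≡⟨ ∑-cong R (λ c → *-fibre c t) ⟩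
  ∑ R (λ _ → length (perms ℓ))             ≡⟨ ∑-const R _ ⟩
  length R * length (perms ℓ) ∎
  where open ≡-Reasoning

-- coverings ℓ m r counts the words of length m over ℓ letters that contain all of r given letters:
-- the first letter either avoids the r letters or is one of them.
coverings : ℕ → ℕ → ℕ → ℕ
coverings ℓ zero    zero    = 1
coverings ℓ zero    (suc r) = 0
coverings ℓ (suc m) r       = (ℓ ∸ r) * coverings ℓ m r + r * coverings ℓ m (r ∸ 1)

coverings-remove : ∀ ℓ m s k r → k ≤ 1 → s + k ≡ r →
                   coverings ℓ m s + k * coverings ℓ m r ≡ coverings ℓ m r + k * coverings ℓ m (r ∸ 1)
coverings-remove ℓ m s zero          r _ refl rewrite +-identityʳ s = refl
coverings-remove ℓ m s (suc zero)    r _ refl rewrite +-comm s 1 = begin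
  coverings ℓ m s + (coverings ℓ m (suc s) + 0) ≡⟨ cong (coverings ℓ m s +_) (+-identityʳ _) ⟩
  coverings ℓ m s + coverings ℓ m (suc s)       ≡⟨ +-comm (coverings ℓ m s) _ ⟩
  coverings ℓ m (suc s) + coverings ℓ m s       ≡⟨ cong (coverings ℓ m (suc s) +_) (+-identityʳ _) ⟨
  coverings ℓ m (suc s) + (coverings ℓ m s + 0) ∎
  where open ≡-Reasoning
coverings-remove ℓ m s (suc (suc k)) r (s≤s ()) _

-- Every colour is matched with t by exactly |P|/ℓ of the matchings, so averaging over π turns the
-- coverings of the unblocked colours into the recurrence defining coverings (1 + m).
∑-coverings-unblocked : ∀ m t (R : List (Fin ℓ)) → Unique R → length R ≤ ℓ →
  ℓ * ∑ (perms ℓ) (λ π → coverings ℓ m (length (unblocked π t R))) ≡ length (perms ℓ) * coverings ℓ (suc m) (length R)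
∑-coverings-unblocked {ℓ} m t R uniq r≤ℓ = +-cancelʳ-≡ (r * |P| * Hr) _ _ (begin
  ℓ * S + r * |P| * Hr         ≡⟨ cong (λ x → ℓ * S + x * Hr) (*-∑-hits t R) ⟨
  ℓ * S + ℓ * K * Hr           ≡⟨ distrib₁ ℓ S K Hr ⟩
  ℓ * (S + K * Hr)             ≡⟨ cong (ℓ *_) S+K*Hr ⟩
  ℓ * (|P| * Hr + K * H′)      ≡⟨ distrib₂ ℓ |P| Hr K H′ ⟩
  ℓ * |P| * Hr + ℓ * K * H′    ≡⟨ cong (λ x → ℓ * |P| * Hr + x * H′) (*-∑-hits t R) ⟩
  ℓ * |P| * Hr + r * |P| * H′  ≡⟨ cong (λ x → x * |P| * Hr + r * |P| * H′) (m∸n+n≡m r≤ℓ) ⟨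
  (ℓ ∸ r + r) * |P| * Hr + r * |P| * H′
                               ≡⟨ distrib₃ (ℓ ∸ r) r |P| Hr H′ ⟩
  |P| * ((ℓ ∸ r) * Hr + r * H′) + r * |P| * Hr ∎)
  where
  open ≡-Reasoning
  r   = length R
  |P| = length (perms ℓ)
  S   = ∑ (perms ℓ) (λ π → coverings ℓ m (length (unblocked π t R)))
  K   = ∑ (perms ℓ) (λ π → hits π t R)
  Hr  = coverings ℓ m r
  H′  = coverings ℓ m (r ∸ 1)
  distrib₁ : ∀ l s k h → l * s + l * k * h ≡ l * (s + k * h)
  distrib₁ = solve-∀
  distrib₂ : ∀ l p h k h′ → l * (p * h + k * h′) ≡ l * p * h + l * k * h′
  distrib₂ = solve-∀
  distrib₃ : ∀ d r p h h′ → (d + r) * p * h + r * p * h′ ≡ p * (d * h + r * h′) + r * p * h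
  distrib₃ = solve-∀
  S+K*Hr : S + K * Hr ≡ |P| * Hr + K * H′
  S+K*Hr = begin
    S + K * Hr
      ≡⟨ cong (S +_) (∑-*ʳ (perms ℓ) Hr _) ⟨
    S + ∑ (perms ℓ) (λ π → hits π t R * Hr)
      ≡⟨ ∑-+ (perms ℓ) _ _ ⟨
    ∑ (perms ℓ) (λ π → coverings ℓ m (length (unblocked π t R)) + hits π t R * Hr)
      ≡⟨ ∑-cong∈ (perms ℓ) (λ {π} π∈ → coverings-remove ℓ m _ (hits π t R) r
           (hits≤1 t (proj₂ (∈-filter⁻ isPerm? {xs = allFuns ℓ ℓ} π∈)) uniq) (length-unblocked π t R)) ⟩
    ∑ (perms ℓ) (λ π → Hr + hits π t R * H′)
      ≡⟨ ∑-+ (perms ℓ) _ _ ⟩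
    ∑ (perms ℓ) (λ _ → Hr) + ∑ (perms ℓ) (λ π → hits π t R * H′)
      ≡⟨ cong₂ _+_ (∑-const (perms ℓ) Hr) (∑-*ʳ (perms ℓ) H′ _) ⟩
    |P| * Hr + K * H′ ∎

∑-all-blocked : ∀ m (R : List (Fin ℓ)) (φ : Fin m → Fin ℓ) → Unique R → length R ≤ ℓ →
  ∑ (words (perms ℓ) m) (λ πs → 𝟙[ all? (blocked? φ πs) R ]) * ℓ ^ m ≡ length (perms ℓ) ^ m * coverings ℓ m (length R)
∑-all-blocked zero    []      φ _ _ = refl
∑-all-blocked zero    (c ∷ R) φ _ _ = refl
∑-all-blocked {ℓ} (suc m) R φ uniq r≤ℓ = begin
  ∑ (words P (suc m)) (λ πs → 𝟙[ all? (blocked? φ πs) R ]) * (ℓ * ℓ ^ m)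
    ≡⟨ cong (_* (ℓ * ℓ ^ m)) (∑-words-suc P m _) ⟩
  ∑ P (λ π → ∑ (words P m) (λ πs → 𝟙[ all? (blocked? φ (π ∷ πs)) R ])) * (ℓ * ℓ ^ m)
    ≡⟨ cong (_* (ℓ * ℓ ^ m)) (∑-cong P (λ π → ∑-cong (words P m) (λ πs →
         𝟙-⇔ (All-Blocked-∷ φ π πs R) (all? (blocked? φ (π ∷ πs)) R) (all? (blocked? (φ ∘ suc) πs) (R′ π))))) ⟩
  ∑ P G * (ℓ * ℓ ^ m)
    ≡⟨ x∙yz≈y∙xz (∑ P G) ℓ (ℓ ^ m) ⟩
  ℓ * (∑ P G * ℓ ^ m)
    ≡⟨ cong (ℓ *_) (∑-*ʳ P (ℓ ^ m) G) ⟨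
  ℓ * ∑ P (λ π → G π * ℓ ^ m)
    ≡⟨ cong (ℓ *_) (∑-cong P (λ π → ∑-all-blocked m (R′ π) (φ ∘ suc)
         (Unique.filter⁺ (λ c → ¬? (π c ≟ t)) uniq) (≤-trans (length-filter (λ c → ¬? (π c ≟ t)) R) r≤ℓ))) ⟩
  ℓ * ∑ P (λ π → |P| ^ m * coverings ℓ m (length (R′ π)))
    ≡⟨ cong (ℓ *_) (∑-*ˡ P (|P| ^ m) _) ⟩
  ℓ * (|P| ^ m * ∑ P (λ π → coverings ℓ m (length (R′ π))))
    ≡⟨ x∙yz≈y∙xz ℓ (|P| ^ m) _ ⟩
  |P| ^ m * (ℓ * ∑ P (λ π → coverings ℓ m (length (R′ π))))
    ≡⟨ cong (|P| ^ m *_) (∑-coverings-unblocked m t R uniq r≤ℓ) ⟩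
  |P| ^ m * (|P| * coverings ℓ (suc m) (length R))
    ≡⟨ x∙yz≈y∙xz (|P| ^ m) |P| _ ⟩
  |P| * (|P| ^ m * coverings ℓ (suc m) (length R))
    ≡⟨ *-assoc |P| (|P| ^ m) _ ⟨
  |P| * |P| ^ m * coverings ℓ (suc m) (length R) ∎
  where
  open ≡-Reasoning
  P   = perms ℓ
  |P| = length P
  t   = φ zero
  R′ : (Fin ℓ → Fin ℓ) → List (Fin ℓ)
  R′ π = unblocked π t R
  G : (Fin ℓ → Fin ℓ) → ℕ
  G π = ∑ (words P m) (λ πs → 𝟙[ all? (blocked? (φ ∘ suc) πs) (R′ π) ])


-- Estimates

^-distribʳ-* : ∀ a b n → (a * b) ^ n ≡ a ^ n * b ^ n
^-distribʳ-* a b zero    = refl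
^-distribʳ-* a b (suc n) = trans (cong (a * b *_) (^-distribʳ-* a b n)) (*-interchange a b (a ^ n) (b ^ n))

bernoulli : ∀ a b n → a ^ n * (a + suc n * b) ≤ (a + b) ^ suc n
bernoulli a b zero    = ≤-reflexive (base a b)
  where
  base : ∀ a b → 1 * (a + 1 * b) ≡ (a + b) * 1
  base = solve-∀
bernoulli a b (suc n) = begin
  a * a ^ n * (a + (2 + n) * b)                             ≤⟨ m≤m+n _ (a ^ n * (1 + n) * b * b) ⟩
  a * a ^ n * (a + (2 + n) * b) + a ^ n * (1 + n) * b * b   ≡⟨ step a b (a ^ n) n ⟩
  (a + b) * (a ^ n * (a + (1 + n) * b))                     ≤⟨ *-monoʳ-≤ (a + b) (bernoulli a b n) ⟩
  (a + b) * (a + b) ^ suc n ∎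
  where
  open ≤-Reasoning
  step : ∀ a b x n → a * x * (a + (2 + n) * b) + x * (1 + n) * b * b ≡ (a + b) * (x * (a + (1 + n) * b))
  step = solve-∀

[1+c]^h*e≤c^[1+h] : ∀ h e → suc (h + e) ^ h * e ≤ (h + e) ^ suc h
[1+c]^h*e≤c^[1+h] zero    e = ≤-reflexive (trans (+-identityʳ e) (sym (*-identityʳ e)))
[1+c]^h*e≤c^[1+h] (suc h) e = begin
  suc c * suc c ^ h * e           ≡⟨ xy∙z≈y∙xz (suc c) (suc c ^ h) e ⟩
  suc c ^ h * (suc c * e)         ≤⟨ *-monoʳ-≤ (suc c ^ h) (+-monoˡ-≤ (c * e) (m≤n+m e (suc h))) ⟩
  suc c ^ h * (c + c * e)         ≡⟨ cong (λ x → suc c ^ h * (c + x)) (*-comm c e) ⟩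
  suc c ^ h * (suc e * c)         ≡⟨ *-assoc (suc c ^ h) (suc e) c ⟨
  suc c ^ h * suc e * c           ≡⟨ cong (λ x → suc x ^ h * suc e * c) (+-suc h e) ⟨
  suc (h + suc e) ^ h * suc e * c ≤⟨ *-monoˡ-≤ c ([1+c]^h*e≤c^[1+h] h (suc e)) ⟩
  (h + suc e) ^ suc h * c         ≡⟨ cong (λ x → x ^ suc h * c) (+-suc h e) ⟩
  c ^ suc h * c                   ≡⟨ *-comm (c ^ suc h) c ⟩
  c * c ^ suc h ∎
  where
  open ≤-Reasoning
  c = suc (h + e)

[1+c]^m≤2*c^m : ∀ m c → 2 * m ≤ c → suc c ^ m ≤ 2 * c ^ m
[1+c]^m≤2*c^m zero    c _    = s≤s z≤n
[1+c]^m≤2*c^m (suc m) c 2m≤c with m≤n⇒∃[o]m+o≡n (≤-trans (m≤m+n (suc m) (suc m + 0)) 2m≤c)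
... | e , refl = *-cancelʳ-≤ (suc c ^ suc m) (2 * c ^ suc m) e {{>-nonZero (≤-trans (s≤s z≤n) m<e)}} (begin
  suc c ^ suc m * e       ≤⟨ [1+c]^h*e≤c^[1+h] (suc m) e ⟩
  c * c ^ suc m           ≡⟨ *-comm c (c ^ suc m) ⟩
  c ^ suc m * (suc m + e) ≤⟨ *-monoʳ-≤ (c ^ suc m) (+-monoˡ-≤ e m<e) ⟩
  c ^ suc m * (e + e)     ≡⟨ double (c ^ suc m) e ⟩
  2 * c ^ suc m * e ∎)
  where
  open ≤-Reasoning
  m<e : suc m ≤ e
  m<e = ≤-trans (≤-reflexive (sym (+-identityʳ (suc m)))) (+-cancelˡ-≤ (suc m) _ _ 2m≤c)
  double : ∀ x e → x * (e + e) ≡ 2 * x * e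
  double = solve-∀

[1+c]^m≤2^t*c^m : ∀ t m h c → 2 * h ≤ c → m ≤ h * t → suc c ^ m ≤ 2 ^ t * c ^ m
[1+c]^m≤2^t*c^m zero    m h c _ m≤0 rewrite n≤0⇒n≡0 (≤-trans m≤0 (≤-reflexive (*-zeroʳ h))) = s≤s z≤n
[1+c]^m≤2^t*c^m (suc t) m h c 2h≤c m≤h[1+t] with m ≤? h
... | yes m≤h = begin
  suc c ^ m       ≤⟨ [1+c]^m≤2*c^m m c (≤-trans (*-monoʳ-≤ 2 m≤h) 2h≤c) ⟩
  2 * c ^ m       ≤⟨ *-monoˡ-≤ (c ^ m) (*-monoʳ-≤ 2 (^-monoʳ-≤ 2 (z≤n {t}))) ⟩
  2 * 2 ^ t * c ^ m ∎
  where open ≤-Reasoning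
... | no m≰h with m≤n⇒∃[o]m+o≡n (<⇒≤ (≰⇒> m≰h))
... | m′ , refl = begin
  suc c ^ (h + m′)              ≡⟨ ^-distribˡ-+-* (suc c) h m′ ⟩
  suc c ^ h * suc c ^ m′        ≤⟨ *-mono-≤ ([1+c]^m≤2*c^m h c 2h≤c) ([1+c]^m≤2^t*c^m t m′ h c 2h≤c m′≤ht) ⟩
  2 * c ^ h * (2 ^ t * c ^ m′)  ≡⟨ *-interchange 2 (c ^ h) (2 ^ t) (c ^ m′) ⟩
  2 * 2 ^ t * (c ^ h * c ^ m′)  ≡⟨ cong (2 * 2 ^ t *_) (^-distribˡ-+-* c h m′) ⟨
  2 * 2 ^ t * c ^ (h + m′) ∎
  where
  open ≤-Reasoning
  m′≤ht : m′ ≤ h * t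
  m′≤ht = +-cancelˡ-≤ h m′ (h * t) (≤-trans m≤h[1+t] (≤-reflexive (*-suc h t)))

d^[1+d]*2≤[1+d]^[1+d] : ∀ d → d ^ suc d * 2 ≤ suc d ^ suc d
d^[1+d]*2≤[1+d]^[1+d] d = begin
  d ^ suc d * 2        ≡⟨ regroup d (d ^ d) ⟩
  d ^ d * (d + d)      ≤⟨ *-monoʳ-≤ (d ^ d) (+-monoʳ-≤ d (≤-trans (n≤1+n d) (≤-reflexive (sym (*-identityʳ (suc d)))))) ⟩
  d ^ d * (d + suc d * 1) ≤⟨ bernoulli d 1 d ⟩
  (d + 1) ^ suc d      ≡⟨ cong (_^ suc d) (+-comm d 1) ⟩
  suc d ^ suc d ∎
  where
  open ≤-Reasoning
  regroup : ∀ d x → d * x * 2 ≡ x * (d + d)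
  regroup = solve-∀

d^L*2^Q≤[1+d]^L : ∀ d Q L → suc d * Q ≤ L → d ^ L * 2 ^ Q ≤ suc d ^ L
d^L*2^Q≤[1+d]^L d Q L le with m≤n⇒∃[o]m+o≡n le
... | e , refl = begin
  d ^ (suc d * Q + e) * 2 ^ Q       ≡⟨ cong (_* 2 ^ Q) (^-distribˡ-+-* d (suc d * Q) e) ⟩
  d ^ (suc d * Q) * d ^ e * 2 ^ Q   ≡⟨ xy∙z≈xz∙y (d ^ (suc d * Q)) (d ^ e) (2 ^ Q) ⟩
  d ^ (suc d * Q) * 2 ^ Q * d ^ e   ≡⟨ cong (λ x → x * 2 ^ Q * d ^ e) (^-*-assoc d (suc d) Q) ⟨
  (d ^ suc d) ^ Q * 2 ^ Q * d ^ e   ≡⟨ cong (_* d ^ e) (^-distribʳ-* (d ^ suc d) 2 Q) ⟨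
  (d ^ suc d * 2) ^ Q * d ^ e       ≤⟨ *-mono-≤ (^-monoˡ-≤ Q (d^[1+d]*2≤[1+d]^[1+d] d)) (^-monoˡ-≤ e (n≤1+n d)) ⟩
  (suc d ^ suc d) ^ Q * suc d ^ e   ≡⟨ cong (_* suc d ^ e) (^-*-assoc (suc d) (suc d) Q) ⟩
  suc d ^ (suc d * Q) * suc d ^ e   ≡⟨ ^-distribˡ-+-* (suc d) (suc d * Q) e ⟨
  suc d ^ (suc d * Q + e) ∎
  where open ≤-Reasoning

[ℓ∸r]*p+r*[p+q]≡ℓ*p+r*q : ∀ ℓ r p q → r ≤ ℓ → (ℓ ∸ r) * p + r * (p + q) ≡ ℓ * p + r * q
[ℓ∸r]*p+r*[p+q]≡ℓ*p+r*q ℓ r p q r≤ℓ = begin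
  (ℓ ∸ r) * p + r * (p + q)   ≡⟨ regroup (ℓ ∸ r) p r q ⟩
  (ℓ ∸ r + r) * p + r * q     ≡⟨ cong (λ x → x * p + r * q) (m∸n+n≡m r≤ℓ) ⟩
  ℓ * p + r * q ∎
  where
  open ≡-Reasoning
  regroup : ∀ d p r q → d * p + r * (p + q) ≡ (d + r) * p + r * q
  regroup = solve-∀

[1+c]*[p+q]∸c*q≡[1+c]*p+q : ∀ c p q → suc c * (p + q) ∸ c * q ≡ suc c * p + q
[1+c]*[p+q]∸c*q≡[1+c]*p+q c p q = begin
  suc c * (p + q) ∸ c * q         ≡⟨ cong (_∸ c * q) (regroup c p q) ⟩
  suc c * p + q + c * q ∸ c * q   ≡⟨ m+n∸n≡m (suc c * p + q) (c * q) ⟩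
  suc c * p + q ∎
  where
  open ≡-Reasoning
  regroup : ∀ c p q → suc c * (p + q) ≡ suc c * p + q + c * q
  regroup = solve-∀

-- With ℓ = 1 + c, X = ℓ^m and q = c^m this says coverings ℓ m r / X ≤ (1 − q/X)^r: the events
-- "colour i occurs among m random colours" are negatively correlated.
coverings≤ : ∀ c m r → r ≤ suc c → coverings (suc c) m r * (suc c ^ m) ^ r ≤ suc c ^ m * (suc c ^ m ∸ c ^ m) ^ r
coverings≤ c zero    zero    _ = ≤-refl
coverings≤ c zero    (suc r) _ = z≤n
coverings≤ c (suc m) zero    _ = begin
  (suc c * coverings (suc c) m 0 + 0) * 1  ≡⟨ regroup (suc c) (coverings (suc c) m 0) ⟩
  suc c * (coverings (suc c) m 0 * 1)      ≤⟨ *-monoʳ-≤ (suc c) (coverings≤ c m zero z≤n) ⟩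
  suc c * (suc c ^ m * 1)                  ≡⟨ *-assoc (suc c) (suc c ^ m) 1 ⟨
  suc c * suc c ^ m * 1 ∎
  where
  open ≤-Reasoning
  regroup : ∀ a b → (a * b + 0) * 1 ≡ a * (b * 1)
  regroup = solve-∀
coverings≤ c (suc m) (suc s) r≤L = begin
  (d * Hr + r * Hs) * (L * X) ^ r
    ≡⟨ cong ((d * Hr + r * Hs) *_) (^-distribʳ-* L X r) ⟩
  (d * Hr + r * Hs) * (L ^ r * (X * X ^ s))
    ≡⟨ expand₁ d Hr r Hs (L ^ r) X (X ^ s) ⟩
  d * L ^ r * (Hr * (X * X ^ s)) + r * L ^ r * X * (Hs * X ^ s)
    ≤⟨ +-mono-≤ (*-monoʳ-≤ (d * L ^ r) (coverings≤ c m r r≤L))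
                (*-monoʳ-≤ (r * L ^ r * X) (coverings≤ c m s (≤-trans (n≤1+n s) r≤L))) ⟩
  d * L ^ r * (X * (p * p ^ s)) + r * L ^ r * X * (X * p ^ s)
    ≡⟨ expand₂ d L (L ^ s) X p (p ^ s) r ⟩
  L * X * (L ^ s * p ^ s * (d * p + r * X))
    ≡⟨ cong (λ x → L * X * (L ^ s * p ^ s * x)) dp+rX ⟩
  L * X * (L ^ s * p ^ s * (L * p + r * q))
    ≡⟨ cong (λ x → L * X * (x * (L * p + r * q))) (^-distribʳ-* L p s) ⟨
  L * X * ((L * p) ^ s * (L * p + r * q))
    ≤⟨ *-monoʳ-≤ (L * X) (bernoulli (L * p) q s) ⟩
  L * X * (L * p + q) ^ r
    ≡⟨ cong (λ x → L * X * x ^ r) LX∸cq ⟨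
  L * X * (L * X ∸ c * q) ^ r ∎
  where
  open ≤-Reasoning
  L = suc c
  r = suc s
  X = L ^ m
  q = c ^ m
  p = X ∸ q
  d = L ∸ r
  Hr = coverings L m r
  Hs = coverings L m s
  X≡p+q : X ≡ p + q
  X≡p+q = sym (m∸n+n≡m (^-monoˡ-≤ m (n≤1+n c)))
  expand₁ : ∀ d h r h′ L x y → (d * h + r * h′) * (L * (x * y)) ≡ d * L * (h * (x * y)) + r * L * x * (h′ * y)
  expand₁ = solve-∀
  expand₂ : ∀ d l lˢ x p pˢ r → d * (l * lˢ) * (x * (p * pˢ)) + r * (l * lˢ) * x * (x * pˢ) ≡ l * x * (lˢ * pˢ * (d * p + r * x))
  expand₂ = solve-∀
  dp+rX : d * p + r * X ≡ L * p + r * q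
  dp+rX = trans (cong (λ x → d * p + r * x) X≡p+q) ([ℓ∸r]*p+r*[p+q]≡ℓ*p+r*q L r p q r≤L)
  LX∸cq : L * X ∸ c * q ≡ L * p + q
  LX∸cq = trans (cong (λ x → L * x ∸ c * q) X≡p+q) ([1+c]*[p+q]∸c*q≡[1+c]*p+q c p q)

-- If (1 + 1/c)^m ≤ 1 + d, then a fixed colour is missed by m random colours with probability at
-- least 1/(1 + d), so all 1 + c ≥ (1 + d) Q colours are covered with probability at most 2^(−Q).
K*coverings≤ : ∀ c d Q K m → suc c ^ m ≤ suc d * c ^ m → suc d * Q ≤ suc c → K ≤ 2 ^ Q →
               K * coverings (suc c) m (suc c) ≤ suc c ^ m
K*coverings≤ c d Q K m L^m≤ DQ≤L K≤2^Q = *-cancelʳ-≤ _ _ (X ^ L) {{m^n≢0 X L {{m^n≢0 L m}}}} (begin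
  K * coverings L m L * X ^ L   ≡⟨ *-assoc K (coverings L m L) (X ^ L) ⟩
  K * (coverings L m L * X ^ L) ≤⟨ *-monoʳ-≤ K (coverings≤ c m L ≤-refl) ⟩
  K * (X * p ^ L)               ≡⟨ x∙yz≈y∙xz K X (p ^ L) ⟩
  X * (K * p ^ L)               ≤⟨ *-monoʳ-≤ X K*p^L≤X^L ⟩
  X * X ^ L ∎)
  where
  open ≤-Reasoning
  L = suc c
  X = L ^ m
  q = c ^ m
  p = X ∸ q
  D = suc d
  p*D≤X*d : p * D ≤ X * d
  p*D≤X*d = begin
    p * D             ≡⟨ *-distribʳ-∸ D X q ⟩
    X * D ∸ q * D     ≤⟨ ∸-monoʳ-≤ (X * D) (≤-trans L^m≤ (≤-reflexive (*-comm D q))) ⟩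
    X * D ∸ X         ≡⟨ cong (_∸ X) (*-suc X d) ⟩
    X + X * d ∸ X     ≡⟨ m+n∸m≡n X (X * d) ⟩
    X * d ∎
  K*p^L≤X^L : K * p ^ L ≤ X ^ L
  K*p^L≤X^L = *-cancelʳ-≤ _ _ (D ^ L) {{m^n≢0 D L}} (begin
    K * p ^ L * D ^ L         ≡⟨ *-assoc K (p ^ L) (D ^ L) ⟩
    K * (p ^ L * D ^ L)       ≡⟨ cong (K *_) (^-distribʳ-* p D L) ⟨
    K * (p * D) ^ L           ≤⟨ *-mono-≤ K≤2^Q (^-monoˡ-≤ L p*D≤X*d) ⟩
    2 ^ Q * (X * d) ^ L       ≡⟨ cong (2 ^ Q *_) (^-distribʳ-* X d L) ⟩
    2 ^ Q * (X ^ L * d ^ L)   ≡⟨ x∙yz≈y∙xz (2 ^ Q) (X ^ L) (d ^ L) ⟩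
    X ^ L * (2 ^ Q * d ^ L)   ≡⟨ cong (X ^ L *_) (*-comm (2 ^ Q) (d ^ L)) ⟩
    X ^ L * (d ^ L * 2 ^ Q)   ≤⟨ *-monoʳ-≤ (X ^ L) (d^L*2^Q≤[1+d]^L d Q L DQ≤L) ⟩
    X ^ L * D ^ L ∎)


K*∑stuck≤ : ∀ {ℓ} .{{_ : NonZero ℓ}} K m → K * coverings ℓ m ℓ ≤ ℓ ^ m →
            ∀ (φ : Fin m → Fin ℓ) → K * ∑ (words (perms ℓ) m) (stuck (just φ)) ≤ length (perms ℓ) ^ m
K*∑stuck≤ {ℓ} K m K*cov≤ φ = *-cancelʳ-≤ _ _ (ℓ ^ m) {{m^n≢0 ℓ m}} (begin
  K * ∑ (words P m) (stuck (just φ)) * ℓ ^ m             ≡⟨ *-assoc K _ (ℓ ^ m) ⟩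
  K * (∑ (words P m) (stuck (just φ)) * ℓ ^ m)
    ≡⟨ cong (K *_) (∑-all-blocked m (allFin ℓ) φ (Unique.allFin⁺ ℓ) (≤-reflexive (length-allFin ℓ))) ⟩
  K * (length P ^ m * coverings ℓ m (length (allFin ℓ)))
    ≡⟨ cong (λ r → K * (length P ^ m * coverings ℓ m r)) (length-allFin ℓ) ⟩
  K * (length P ^ m * coverings ℓ m ℓ)                   ≡⟨ x∙yz≈y∙xz K (length P ^ m) _ ⟩
  length P ^ m * (K * coverings ℓ m ℓ)                   ≤⟨ *-monoʳ-≤ (length P ^ m) K*cov≤ ⟩
  length P ^ m * ℓ ^ m ∎)
  where
  open ≤-Reasoning
  P = perms ℓ

greedySucceeds? : ∀ n ℓ (πs : List (Fin ℓ → Fin ℓ)) → Dec (Is-just (greedy n πs))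
greedySucceeds? n ℓ πs = Maybe.dec (λ _ → yes tt) (greedy n πs)

greedy-colorable : ∀ n ℓ (πs : List (Fin ℓ → Fin ℓ)) → Is-just (greedy n πs) → Colorable n ℓ πs
greedy-colorable n ℓ πs succeeds with greedy n πs in eq | succeeds
... | just φ | _ = φ , greedy-respects n πs eq

𝟙-succeeds+fails≡1 : ∀ n ℓ (πs : List (Fin ℓ → Fin ℓ)) → 𝟙[ greedySucceeds? n ℓ πs ] + fails (greedy n πs) ≡ 1
𝟙-succeeds+fails≡1 n ℓ πs with greedy n πs
... | just _  = refl
... | nothing = refl

probColorable : ∀ n ℓ k .{{_ : NonZero ℓ}} → 0 < n →
                (∀ m → m < n → suc k * n * coverings ℓ m ℓ ≤ ℓ ^ m) → ProbColorableAtLeast n ℓ k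
probColorable n ℓ k 0<n coverings-small =
  S , filter-⊆ (greedySucceeds? n ℓ) (samples n ℓ) ,
  All.tabulate (λ πs∈S → greedy-colorable n ℓ _ (proj₂ (∈-filter⁻ (greedySucceeds? n ℓ) {xs = samples n ℓ} πs∈S))) ,
  bound
  where
  S = filter (greedySucceeds? n ℓ) (samples n ℓ)
  T = length (samples n ℓ)
  |S|+failures≡T : length S + failures n ℓ ≡ T
  |S|+failures≡T = begin
    length S + failures n ℓ
      ≡⟨ cong (_+ failures n ℓ) (length-filter≡∑𝟙 (greedySucceeds? n ℓ) (samples n ℓ)) ⟩
    ∑ (samples n ℓ) (λ πs → 𝟙[ greedySucceeds? n ℓ πs ]) + failures n ℓ
      ≡⟨ ∑-+ (samples n ℓ) _ _ ⟨
    ∑ (samples n ℓ) (λ πs → 𝟙[ greedySucceeds? n ℓ πs ] + fails (greedy n πs))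
      ≡⟨ ∑-cong (samples n ℓ) (𝟙-succeeds+fails≡1 n ℓ) ⟩
    ∑ (samples n ℓ) (λ _ → 1)
      ≡⟨ length≡∑1 (samples n ℓ) ⟨
    T ∎
    where open ≡-Reasoning
  failures-small : suc k * n * failures n ℓ ≤ n * T
  failures-small = failures-bound (suc k * n) n ℓ (λ m m<n → K*∑stuck≤ (suc k * n) m (coverings-small m m<n))
  bound : suc k * (T ∸ length S) ≤ T
  bound = begin
    suc k * (T ∸ length S)                       ≡⟨ cong (λ x → suc k * (x ∸ length S)) |S|+failures≡T ⟨
    suc k * (length S + failures n ℓ ∸ length S) ≡⟨ cong (suc k *_) (m+n∸m≡n (length S) (failures n ℓ)) ⟩
    suc k * failures n ℓ                         ≤⟨ *-cancelʳ-≤ _ _ n {{>-nonZero 0<n}} (begin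
      suc k * failures n ℓ * n   ≡⟨ xy∙z≈xz∙y (suc k) (failures n ℓ) n ⟩
      suc k * n * failures n ℓ   ≤⟨ failures-small ⟩
      n * T                      ≡⟨ *-comm n T ⟩
      T * n ∎) ⟩
    T ∎
    where open ≤-Reasoning

-- The number of colours

2^m≤n⇒m≤⌊log₂n⌋ : ∀ m n → 2 ^ m ≤ n → m ≤ ⌊log₂ n ⌋
2^m≤n⇒m≤⌊log₂n⌋ m n 2^m≤n = ≤-trans (≤-reflexive (sym (⌊log₂[2^n]⌋≡n m))) (⌊log₂⌋-mono-≤ 2^m≤n)

n<2^[1+⌊log₂n⌋] : ∀ n → n < 2 ^ suc ⌊log₂ n ⌋
n<2^[1+⌊log₂n⌋] n = ≰⇒> (λ 2^[1+⌊log₂n⌋]≤n → <-irrefl refl (2^m≤n⇒m≤⌊log₂n⌋ _ n 2^[1+⌊log₂n⌋]≤n))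

2^⌊log₂n⌋≤n : ∀ n .{{_ : NonZero n}} → 2 ^ ⌊log₂ n ⌋ ≤ n
2^⌊log₂n⌋≤n (suc n) = 2^⌊log2⌋≤ n (<-wellFounded (suc n))
  where
  2^⌊log2⌋≤ : ∀ n (rec : Acc _<_ (suc n)) → 2 ^ ⌊log2⌋ (suc n) rec ≤ suc n
  2^⌊log2⌋≤ zero    _        = ≤-refl
  2^⌊log2⌋≤ (suc n) (acc rs) = begin
    2 * 2 ^ ⌊log2⌋ (suc ⌊ n /2⌋) (rs 1+⌊n/2⌋<2+n) ≤⟨ *-monoʳ-≤ 2 (2^⌊log2⌋≤ ⌊ n /2⌋ (rs 1+⌊n/2⌋<2+n)) ⟩
    2 * suc ⌊ n /2⌋                         ≡⟨ *-suc 2 ⌊ n /2⌋ ⟩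
    2 + 2 * ⌊ n /2⌋                         ≤⟨ +-monoʳ-≤ 2 2⌊n/2⌋≤n ⟩
    2 + n ∎
    where
    open ≤-Reasoning
    1+⌊n/2⌋<2+n : suc ⌊ n /2⌋ < suc (suc n)
    1+⌊n/2⌋<2+n = ⌊n/2⌋<n (suc n)
    2⌊n/2⌋≤n : 2 * ⌊ n /2⌋ ≤ n
    2⌊n/2⌋≤n = ≤-trans (+-monoʳ-≤ ⌊ n /2⌋ (≤-trans (≤-reflexive (+-identityʳ _)) (⌊n/2⌋≤⌈n/2⌉ n)))
                       (≤-reflexive (⌊n/2⌋+⌈n/2⌉≡n n))

n<2^n : ∀ n → n < 2 ^ n
n<2^n zero    = s≤s z≤n
n<2^n (suc n) = +-mono-≤-< (m^n>0 2 n) (≤-trans (n<2^n n) (≤-reflexive (sym (+-identityʳ _))))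

5*s+4≤2^[2*s] : ∀ s → 2 ≤ s → 5 * s + 4 ≤ 2 ^ (2 * s)
5*s+4≤2^[2*s] (suc (suc zero))    _ = m≤m+n 14 2
5*s+4≤2^[2*s] (suc zero)          (s≤s ())
5*s+4≤2^[2*s] (suc (suc (suc s))) _ = begin
  5 * suc S + 4                   ≡⟨ regroup₁ S ⟩
  5 * S + 4 + 5                   ≤⟨ +-mono-≤ (5*s+4≤2^[2*s] (suc (suc s)) (s≤s (s≤s z≤n))) 5≤3*4^S ⟩
  2 ^ (2 * S) + 3 * 2 ^ (2 * S)   ≡⟨ regroup₂ (2 ^ (2 * S)) ⟩
  2 * (2 * 2 ^ (2 * S))           ≡⟨ cong (2 ^_) (regroup₃ S) ⟨
  2 ^ (2 * suc S) ∎
  where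
  open ≤-Reasoning
  S = suc (suc s)
  regroup₁ : ∀ S → 5 * suc S + 4 ≡ 5 * S + 4 + 5
  regroup₁ = solve-∀
  regroup₂ : ∀ x → x + 3 * x ≡ 2 * (2 * x)
  regroup₂ = solve-∀
  regroup₃ : ∀ S → 2 * suc S ≡ suc (suc (2 * S))
  regroup₃ = solve-∀
  5≤3*4^S : 5 ≤ 3 * 2 ^ (2 * S)
  5≤3*4^S = ≤-trans (m≤m+n 5 7) (*-monoʳ-≤ 3 (^-monoʳ-≤ 2 {2} {2 * S} (≤-trans (s≤s (s≤s z≤n)) (m≤m+n S (S + 0)))))

-- With j = ⌊log₂ n⌋ and t = ⌊j/4⌋ + 1 we take ℓ = 2h + 1 colours, where h = ⌊2^(j+1)/t⌋ + 1 > n/t;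
-- then (1 + 1/(2h))^n ≤ 2^t, and ℓ ≈ 16 n / log₂ n.
doublings : ℕ → ℕ
doublings j = suc (j / 4)

halfColours : ℕ → ℕ
halfColours j = suc (2 ^ suc j / doublings j)

colours : ℕ → ℕ
colours n = suc (2 * halfColours ⌊log₂ n ⌋)

2^[1+j]<h*t : ∀ j → 2 ^ suc j < halfColours j * doublings j
2^[1+j]<h*t j = begin-strict
  x                  ≡⟨ m≡m%n+[m/n]*n x t ⟩
  x % t + x / t * t  <⟨ +-monoˡ-< (x / t * t) (m%n<n x t) ⟩
  t + x / t * t      ≡⟨⟩
  halfColours j * t ∎
  where
  open ≤-Reasoning
  x = 2 ^ suc j
  t = doublings j

h*t≤2^[1+j]+t : ∀ j → halfColours j * doublings j ≤ 2 ^ suc j + doublings j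
h*t≤2^[1+j]+t j = ≤-trans (≤-reflexive (+-comm (doublings j) _)) (+-monoˡ-≤ (doublings j) (m/n*n≤m (2 ^ suc j) (doublings j)))

4*⌊j/4⌋≤j : ∀ j → 4 * (j / 4) ≤ j
4*⌊j/4⌋≤j j = ≤-trans (≤-reflexive (*-comm 4 (j / 4))) (m/n*n≤m j 4)

j<4*t : ∀ j → j < 4 * doublings j
j<4*t j = begin-strict
  j                  ≡⟨ m≡m%n+[m/n]*n j 4 ⟩
  j % 4 + j / 4 * 4  <⟨ +-monoˡ-< (j / 4 * 4) (m%n<n j 4) ⟩
  4 + j / 4 * 4      ≡⟨ regroup (j / 4) ⟩
  4 * suc (j / 4) ∎
  where
  open ≤-Reasoning
  regroup : ∀ s → 4 + s * 4 ≡ 4 * suc s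
  regroup = solve-∀

t≤j : ∀ j → 4 ≤ j → doublings j ≤ j
t≤j j 4≤j = ≤-trans (+-monoˡ-≤ s 1≤s) (≤-trans (+-monoʳ-≤ s (m≤m+n s _)) (4*⌊j/4⌋≤j j))
  where
  s = j / 4
  1≤s : 1 ≤ s
  1≤s = /-monoˡ-≤ 4 4≤j

colours-Θ : ThetaNOverLog colours
colours-Θ = 0 , 0 , 28 , 16 , λ n 16≤n → *-monoʳ-≤ 1 (n≤ℓ*j n 16≤n) , ℓ*j≤28n n 16≤n
  where
  module _ (n : ℕ) (16≤n : 16 ≤ n) where
    j = ⌊log₂ n ⌋
    t = doublings j
    h = halfColours j
    4≤j : 4 ≤ j
    4≤j = 2^m≤n⇒m≤⌊log₂n⌋ 4 n 16≤n
    n≤ℓ*j : n ≤ colours n * j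
    n≤ℓ*j = begin
      n            ≤⟨ <⇒≤ (n<2^[1+⌊log₂n⌋] n) ⟩
      2 ^ suc j    ≤⟨ <⇒≤ (2^[1+j]<h*t j) ⟩
      h * t        ≤⟨ *-mono-≤ (≤-trans (m≤m+n h (h + 0)) (n≤1+n _)) (t≤j j 4≤j) ⟩
      colours n * j ∎
      where open ≤-Reasoning
    ℓ*j≤28n : colours n * j ≤ 28 * n
    ℓ*j≤28n = begin
      colours n * j                 ≤⟨ *-monoʳ-≤ (colours n) (<⇒≤ (j<4*t j)) ⟩
      suc (2 * h) * (4 * t)         ≡⟨ regroup₁ h t ⟩
      8 * (h * t) + 4 * t           ≤⟨ +-monoˡ-≤ (4 * t) (*-monoʳ-≤ 8 (h*t≤2^[1+j]+t j)) ⟩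
      8 * (2 * 2 ^ j + t) + 4 * t   ≡⟨ regroup₂ (2 ^ j) t ⟩
      16 * 2 ^ j + 12 * t           ≤⟨ +-monoʳ-≤ (16 * 2 ^ j) (*-monoʳ-≤ 12 (≤-trans (t≤j j 4≤j) (<⇒≤ (n<2^n j)))) ⟩
      16 * 2 ^ j + 12 * 2 ^ j       ≡⟨ regroup₃ (2 ^ j) ⟩
      28 * 2 ^ j                    ≤⟨ *-monoʳ-≤ 28 (2^⌊log₂n⌋≤n n {{>-nonZero (≤-trans (s≤s z≤n) 16≤n)}}) ⟩
      28 * n ∎
      where
      open ≤-Reasoning
      regroup₁ : ∀ h t → suc (2 * h) * (4 * t) ≡ 8 * (h * t) + 4 * t
      regroup₁ = solve-∀
      regroup₂ : ∀ x t → 8 * (2 * x + t) + 4 * t ≡ 16 * x + 12 * t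
      regroup₂ = solve-∀
      regroup₃ : ∀ x → 16 * x + 12 * x ≡ 28 * x
      regroup₃ = solve-∀

2^t*Q*t≤2^[1+j] : ∀ k j → 4 * (2 + k) ≤ j → 2 ^ doublings j * (k + suc j) * doublings j ≤ 2 ^ suc j
2^t*Q*t≤2^[1+j] k j 4[2+k]≤j = begin
  2 ^ suc s * (k + suc j) * suc s    ≤⟨ *-mono-≤ (*-monoʳ-≤ (2 ^ suc s) Q≤5s+4) (n<2^n s) ⟩
  2 ^ suc s * (5 * s + 4) * 2 ^ s    ≤⟨ *-monoˡ-≤ (2 ^ s) (*-monoʳ-≤ (2 ^ suc s) (5*s+4≤2^[2*s] s 2≤s)) ⟩
  2 ^ suc s * 2 ^ (2 * s) * 2 ^ s    ≡⟨ cong (_* 2 ^ s) (^-distribˡ-+-* 2 (suc s) (2 * s)) ⟨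
  2 ^ (suc s + 2 * s) * 2 ^ s        ≡⟨ ^-distribˡ-+-* 2 (suc s + 2 * s) s ⟨
  2 ^ (suc s + 2 * s + s)            ≡⟨ cong (2 ^_) (regroup s) ⟩
  2 ^ suc (4 * s)                    ≤⟨ ^-monoʳ-≤ 2 (s≤s (4*⌊j/4⌋≤j j)) ⟩
  2 ^ suc j ∎
  where
  open ≤-Reasoning
  s = j / 4
  2+k≤s : 2 + k ≤ s
  2+k≤s = ≤-trans (≤-reflexive (sym (m*n/n≡m (2 + k) 4))) (/-monoˡ-≤ 4 (≤-trans (≤-reflexive (*-comm (2 + k) 4)) 4[2+k]≤j))
  2≤s : 2 ≤ s
  2≤s = ≤-trans (s≤s (s≤s z≤n)) 2+k≤s
  Q≤5s+4 : k + suc j ≤ 5 * s + 4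
  Q≤5s+4 = ≤-trans (+-mono-≤ (≤-trans (m≤n+m k 2) 2+k≤s) (≤-trans (j<4*t j) (≤-reflexive (regroup₁ s))))
                   (≤-reflexive (regroup₂ s))
    where
    regroup₁ : ∀ s → 4 * suc s ≡ 4 * s + 4
    regroup₁ = solve-∀
    regroup₂ : ∀ s → s + (4 * s + 4) ≡ 5 * s + 4
    regroup₂ = solve-∀
  regroup : ∀ s → suc s + 2 * s + s ≡ suc (4 * s)
  regroup = solve-∀

2^t*Q≤colours : ∀ k n → 4 * (2 + k) ≤ ⌊log₂ n ⌋ → 2 ^ doublings ⌊log₂ n ⌋ * (k + suc ⌊log₂ n ⌋) ≤ colours n
2^t*Q≤colours k n 4[2+k]≤j = begin
  2 ^ t * Q             ≡⟨ m*n/n≡m (2 ^ t * Q) t ⟨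
  2 ^ t * Q * t / t     ≤⟨ /-monoˡ-≤ t (2^t*Q*t≤2^[1+j] k j 4[2+k]≤j) ⟩
  2 ^ suc j / t         ≤⟨ n≤1+n _ ⟩
  halfColours j         ≤⟨ m≤m+n _ (halfColours j + 0) ⟩
  2 * halfColours j     ≤⟨ n≤1+n _ ⟩
  colours n ∎
  where
  open ≤-Reasoning
  j = ⌊log₂ n ⌋
  t = doublings j
  Q = k + suc j

K*coverings[colours]≤ : ∀ k n → 2 ^ (4 * (2 + k)) ≤ n →
                         ∀ m → m < n → suc k * n * coverings (colours n) m (colours n) ≤ colours n ^ m
K*coverings[colours]≤ k n N≤n m m<n = K*coverings≤ (2 * h) (2 ^ t ∸ 1) (k + suc j) (suc k * n) m
  (subst (λ D → suc (2 * h) ^ m ≤ D * (2 * h) ^ m) (sym 1+[2^t∸1]≡2^t)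
         ([1+c]^m≤2^t*c^m t m h (2 * h) ≤-refl (<⇒≤ (<-trans m<n (<-trans (n<2^[1+⌊log₂n⌋] n) (2^[1+j]<h*t j))))))
  (subst (λ D → D * (k + suc j) ≤ colours n) (sym 1+[2^t∸1]≡2^t) (2^t*Q≤colours k n (2^m≤n⇒m≤⌊log₂n⌋ _ n N≤n)))
  (begin
    suc k * n          ≤⟨ *-mono-≤ (n<2^n k) (<⇒≤ (n<2^[1+⌊log₂n⌋] n)) ⟩
    2 ^ k * 2 ^ suc j  ≡⟨ ^-distribˡ-+-* 2 k (suc j) ⟨
    2 ^ (k + suc j) ∎)
  where
  open ≤-Reasoning
  j = ⌊log₂ n ⌋
  t = doublings j
  h = halfColours j
  1+[2^t∸1]≡2^t : suc (2 ^ t ∸ 1) ≡ 2 ^ t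
  1+[2^t∸1]≡2^t = trans (+-comm 1 (2 ^ t ∸ 1)) (m∸n+n≡m (m^n>0 2 t))

colours-suffice : ProbTendsToOne colours
colours-suffice k = 2 ^ (4 * (2 + k)) , λ n N≤n →
  probColorable n (colours n) k (≤-trans (m^n>0 2 (4 * (2 + k))) N≤n) (K*coverings[colours]≤ k n N≤n)

theorem3 : ∃ λ (ℓ : ℕ → ℕ) → ThetaNOverLog ℓ × ProbTendsToOne ℓ
theorem3 = colours , colours-Θ , colours-suffice
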